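{- For all $m,n\in\mathbb{N}$, both $$S^m_n:=\sum_{k=0}^n(-1)^kq^{k(k-1)+2m(n-k)}\begin{bmatrix}2n\\2k\end{bmatrix}_q\quad\text{and}\quad T^m_n:=\sum_{0\le k<n}(-1)^kq^{k(k-1)+2m(n-1-k)}\begin{bmatrix}2n\\2k+1\end{bmatrix}_q$$ are divisible by $(-q;q)_n=\prod_{0<k\le n}(1+q^k)$ in $\mathbb{Z}[q]$. Moreover, for any $m,n\in\mathbb{N}$ and $\delta\in\{0,1\}$, $$\sum_{k=0}^n(-1)^kq^{k(k+2m-1)}\begin{bmatrix}2n\\2k+\delta\end{bmatrix}_q\equiv 0\ \ (\mathrm{mod}\ (-q;q)_n)$$ in $\mathbb{Z}[q]$.
   Context: For $n\in\mathbb{N}$, $(a;q)_n=\prod_{0\le k<n}(1-aq^k)$. For $n,k\in\mathbb{N}$, $\begin{bmatrix}n\\k\end{bmatrix}_q=\frac{(q;q)_n}{(q;q)_k(q;q)_{n-k}}$ if $k\le n$ and $0$ if $k>n$ (these are polynomials in $q$ with integer coefficients). -}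

module Defs where

open import Data.Nat using (ℕ; zero; suc)
open import Data.Integer using (ℤ; +_; -[1+_]) renaming (_+_ to _+ℤ_; _*_ to _*ℤ_)
open import Data.List using (List; []; _∷_; map; replicate; _++_)
open import Data.Product using (∃)
open import Relation.Binary.PropositionalEquality using (_≡_)

-- Polynomials in ℤ[q] as coefficient lists (index i = coefficient of q^i).
Poly : Set
Poly = List ℤ

coeff : Poly → ℕ → ℤ
coeff []       _       = + 0
coeff (a ∷ p)  zero    = a
coeff (a ∷ p)  (suc i) = coeff p i

-- equality in ℤ[q]: all coefficients agree (trailing zeros irrelevant)
infix 4 _≈P_
_≈P_ : Poly → Poly → Set
p ≈P r = ∀ i → coeff p i ≡ coeff r i

infixl 6 _+P_
_+P_ : Poly → Poly → Poly
[]      +P r       = r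
(a ∷ p) +P []      = a ∷ p
(a ∷ p) +P (b ∷ r) = (a +ℤ b) ∷ (p +P r)

scale : ℤ → Poly → Poly
scale c p = map (c *ℤ_) p

negP : Poly → Poly
negP = scale -[1+ 0 ]

infixl 7 _*P_
_*P_ : Poly → Poly → Poly
[]      *P r = []
(a ∷ p) *P r = scale a r +P ((+ 0) ∷ (p *P r))

oneP : Poly
oneP = + 1 ∷ []

qpow : ℕ → Poly
qpow k = replicate k (+ 0) ++ (+ 1 ∷ [])

infix 4 _∣P_
_∣P_ : Poly → Poly → Set
d ∣P p = ∃ λ r → p ≈P (d *P r)

poch : Poly → ℕ → Poly
poch a zero    = oneP
poch a (suc n) = poch a n *P (oneP +P negP (a *P qpow n))

-- Gaussian binomial [n choose k]_q, via the q-Pascal recurrence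
-- [n+1, k+1] = [n, k] + q^(k+1) [n, k+1]; it is 0 for k > n.
qbin : ℕ → ℕ → Poly
qbin zero    zero    = oneP
qbin zero    (suc k) = []
qbin (suc n) zero    = oneP
qbin (suc n) (suc k) = qbin n k +P (qpow (suc k) *P qbin n (suc k))

signP : ℕ → Poly → Poly
signP zero    p = p
signP (suc k) p = negP (signP k p)

sumP : ℕ → (ℕ → Poly) → Poly
sumP zero    f = []
sumP (suc n) f = sumP n f +P f n

{-# OPTIONS --safe #-}

-- Let E_N(x,y) = Σₖ (-1)ᵏ q^(k(k-1)) xᵏ y^(N-k) [N,2k] and let O_N(x,y) be the same sum with [N,2k+1].
-- Up to powers of q, the sums of the theorem are E_2n and O_2n at (1, q^2m) and at (q^2m, 1). As (-q;q)_n has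
-- constant term 1, it suffices that (-q;q)_n divides q^j E_2n and q^j O_2n, for some j, at every point (q^2a, q^2b).
-- The two q-Pascal rules give linear relations with monomial coefficients between the values of E_N and O_N at
-- x, q²x and q⁴x, and E_N, O_N are homogeneous: replacing (x, y) by (q²x, q²y) multiplies them by q^2N. Together
-- these carry divisibility from E_N(1, y₀), E_N(q², y₀) and O_N(q², y₀) to every point. For y₀ = q^(2⌊n/2⌋) those
-- three values are monomial multiples of (-q;q)_n, or 0, as an induction on ⌊n/2⌋ with the same recurrences shows.

module Submission where

open import Defs
open import Data.Nat using (ℕ; zero; suc; _+_; _*_; _∸_; _≤_; _<_; _≤?_; z≤n; s≤s)
open import Data.Nat.Properties
  using (+-suc; +-comm; +-identityʳ; *-zeroʳ; +-∸-assoc; ≤-refl; ≤-trans; ≤-pred; m≤m+n; n≤1+n; m≤n⇒m≤1+n; m<n⇒m<1+n;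
         +-monoʳ-≤; +-mono-≤; ≰⇒>; <-irrefl)
open import Data.Nat.Tactic.RingSolver using () renaming (solve-∀ to ℕ-solve-∀)
open import Data.Integer using (+_; -[1+_]) renaming (_+_ to _+ℤ_; _*_ to _*ℤ_)
import Data.Integer.Properties as ℤ
open import Data.Integer.Tactic.RingSolver using () renaming (solve-∀ to ℤ-solve-∀)
open import Data.List using ([]; _∷_)
open import Data.Maybe using (Maybe; just; nothing)
open import Data.Product using (Σ; _,_; _×_; proj₁; proj₂; map₂)
open import Data.Sum using (_⊎_; inj₁; inj₂)
open import Function using (_∘_)
open import Level using (0ℓ)
open import Algebra.Bundles using (CommutativeRing)
open import Algebra.Structures using (IsCommutativeRing)
open import Relation.Nullary using (yes; no)
open import Relation.Binary.Structures using (IsEquivalence)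
open import Relation.Binary.PropositionalEquality using (_≡_; refl; sym; trans; cong; cong₂; subst; subst₂)
import Relation.Binary.Reasoning.Setoid as SetoidReasoning
open import Tactic.RingSolver using (solve-∀)
open import Tactic.RingSolver.Core.AlmostCommutativeRing using (AlmostCommutativeRing; fromCommutativeRing)

-- The ring ℤ[q]

-- A record rather than the bare function type p ≈P r, so that p and r can be inferred.
infix 4 _≋_
record _≋_ (p r : Poly) : Set where
  constructor mk≋
  field coeff-≡ : p ≈P r
open _≋_ public

≋-refl : ∀ {p} → p ≋ p
≋-refl = mk≋ λ _ → refl

≋-sym : ∀ {p r} → p ≋ r → r ≋ p
≋-sym (mk≋ e) = mk≋ λ i → sym (e i)

≋-trans : ∀ {p r s} → p ≋ r → r ≋ s → p ≋ s
≋-trans (mk≋ e) (mk≋ f) = mk≋ λ i → trans (e i) (f i)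

≋-isEquivalence : IsEquivalence _≋_
≋-isEquivalence = record { refl = ≋-refl ; sym = ≋-sym ; trans = ≋-trans }

∷-cong : ∀ {a b p r} → a ≡ b → p ≋ r → a ∷ p ≋ b ∷ r
∷-cong a≡b (mk≋ e) = mk≋ λ { zero → a≡b ; (suc i) → e i }

0∷-zero : ∀ {p} → p ≋ [] → + 0 ∷ p ≋ []
0∷-zero (mk≋ e) = mk≋ λ { zero → refl ; (suc i) → e i }

coeff-+P : ∀ p r i → coeff (p +P r) i ≡ coeff p i +ℤ coeff r i
coeff-+P []      r       i       = sym (ℤ.+-identityˡ _)
coeff-+P (a ∷ p) []      i       = sym (ℤ.+-identityʳ _)
coeff-+P (a ∷ p) (b ∷ r) zero    = refl
coeff-+P (a ∷ p) (b ∷ r) (suc i) = coeff-+P p r i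

coeff-scale : ∀ c p i → coeff (scale c p) i ≡ c *ℤ coeff p i
coeff-scale c []      i       = sym (ℤ.*-zeroʳ c)
coeff-scale c (a ∷ p) zero    = refl
coeff-scale c (a ∷ p) (suc i) = coeff-scale c p i

+P-cong : ∀ {p p′ r r′} → p ≋ p′ → r ≋ r′ → p +P r ≋ p′ +P r′
+P-cong {p} {p′} {r} {r′} (mk≋ e) (mk≋ f) = mk≋ λ i →
  trans (coeff-+P p r i) (trans (cong₂ _+ℤ_ (e i) (f i)) (sym (coeff-+P p′ r′ i)))

+P-comm : ∀ p r → p +P r ≋ r +P p
+P-comm p r = mk≋ λ i →
  trans (coeff-+P p r i) (trans (ℤ.+-comm (coeff p i) (coeff r i)) (sym (coeff-+P r p i)))

+P-assoc : ∀ p r s → (p +P r) +P s ≋ p +P (r +P s)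
+P-assoc p r s = mk≋ λ i → trans (coeff-+P (p +P r) s i) (trans (cong (_+ℤ coeff s i) (coeff-+P p r i))
  (trans (ℤ.+-assoc (coeff p i) (coeff r i) (coeff s i))
  (sym (trans (coeff-+P p (r +P s) i) (cong (coeff p i +ℤ_) (coeff-+P r s i))))))

+P-interchange : ∀ p r s t → (p +P r) +P (s +P t) ≋ (p +P s) +P (r +P t)
+P-interchange p r s t = mk≋ λ i →
  trans (coeff-+P (p +P r) (s +P t) i) (trans (cong₂ _+ℤ_ (coeff-+P p r i) (coeff-+P s t i))
  (trans (interchange (coeff p i) (coeff r i) (coeff s i) (coeff t i))
  (sym (trans (coeff-+P (p +P s) (r +P t) i) (cong₂ _+ℤ_ (coeff-+P p s i) (coeff-+P r t i))))))
  where
  interchange : ∀ a b c d → (a +ℤ b) +ℤ (c +ℤ d) ≡ (a +ℤ c) +ℤ (b +ℤ d)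
  interchange = ℤ-solve-∀

+P-identityʳ : ∀ p → p +P [] ≋ p
+P-identityʳ []      = ≋-refl
+P-identityʳ (a ∷ p) = ≋-refl

scale-cong : ∀ c {p r} → p ≋ r → scale c p ≋ scale c r
scale-cong c {p} {r} (mk≋ e) = mk≋ λ i →
  trans (coeff-scale c p i) (trans (cong (c *ℤ_) (e i)) (sym (coeff-scale c r i)))

negP-cong : ∀ {p r} → p ≋ r → negP p ≋ negP r
negP-cong = scale-cong -[1+ 0 ]

scale-distribˡ : ∀ c p r → scale c (p +P r) ≋ scale c p +P scale c r
scale-distribˡ c p r = mk≋ λ i → trans (coeff-scale c (p +P r) i) (trans (cong (c *ℤ_) (coeff-+P p r i))
  (trans (ℤ.*-distribˡ-+ c (coeff p i) (coeff r i))
  (sym (trans (coeff-+P (scale c p) (scale c r) i) (cong₂ _+ℤ_ (coeff-scale c p i) (coeff-scale c r i))))))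

scale-distribʳ : ∀ c d p → scale (c +ℤ d) p ≋ scale c p +P scale d p
scale-distribʳ c d p = mk≋ λ i → trans (coeff-scale (c +ℤ d) p i) (trans (ℤ.*-distribʳ-+ (coeff p i) c d)
  (sym (trans (coeff-+P (scale c p) (scale d p) i) (cong₂ _+ℤ_ (coeff-scale c p i) (coeff-scale d p i)))))

scale-scale : ∀ c d p → scale c (scale d p) ≋ scale (c *ℤ d) p
scale-scale c d p = mk≋ λ i → trans (coeff-scale c (scale d p) i) (trans (cong (c *ℤ_) (coeff-scale d p i))
  (trans (sym (ℤ.*-assoc c d (coeff p i))) (sym (coeff-scale (c *ℤ d) p i))))

scale-zero : ∀ p → scale (+ 0) p ≋ []
scale-zero p = mk≋ λ i → trans (coeff-scale (+ 0) p i) (ℤ.*-zeroˡ (coeff p i))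

scale-one : ∀ p → scale (+ 1) p ≋ p
scale-one p = mk≋ λ i → trans (coeff-scale (+ 1) p i) (ℤ.*-identityˡ (coeff p i))

negP-inverseʳ : ∀ p → p +P negP p ≋ []
negP-inverseʳ p = mk≋ λ i → trans (coeff-+P p (negP p) i)
  (trans (cong (coeff p i +ℤ_) (coeff-scale -[1+ 0 ] p i)) (cancel (coeff p i)))
  where
  cancel : ∀ x → x +ℤ (-[1+ 0 ] *ℤ x) ≡ + 0
  cancel = ℤ-solve-∀

*P-zeroˡ : ∀ {p} r → p ≋ [] → p *P r ≋ []
*P-zeroˡ {[]}    r _       = ≋-refl
*P-zeroˡ {a ∷ p} r (mk≋ e) = +P-cong (≋-trans (scale-cong′ (e zero)) (scale-zero r))
                                     (0∷-zero (*P-zeroˡ {p} r (mk≋ λ i → e (suc i))))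
  where
  scale-cong′ : ∀ {c d} → c ≡ d → scale c r ≋ scale d r
  scale-cong′ refl = ≋-refl

*P-zeroʳ : ∀ p → p *P [] ≋ []
*P-zeroʳ []      = ≋-refl
*P-zeroʳ (a ∷ p) = 0∷-zero (*P-zeroʳ p)

*P-congˡ : ∀ {p p′} r → p ≋ p′ → p *P r ≋ p′ *P r
*P-congˡ {[]}    {[]}     r e = ≋-refl
*P-congˡ {[]}    {b ∷ p′} r e = ≋-sym (*P-zeroˡ {b ∷ p′} r (≋-sym e))
*P-congˡ {a ∷ p} {[]}     r e = *P-zeroˡ {a ∷ p} r e
*P-congˡ {a ∷ p} {b ∷ p′} r (mk≋ e) =
  +P-cong (mk≋ λ i → cong (λ c → coeff (scale c r) i) (e zero))
          (∷-cong refl (*P-congˡ {p} {p′} r (mk≋ λ i → e (suc i))))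

*P-congʳ : ∀ p {r r′} → r ≋ r′ → p *P r ≋ p *P r′
*P-congʳ []      e = ≋-refl
*P-congʳ (a ∷ p) e = +P-cong (scale-cong a e) (∷-cong refl (*P-congʳ p e))

*P-cong : ∀ {p p′ r r′} → p ≋ p′ → r ≋ r′ → p *P r ≋ p′ *P r′
*P-cong {p′ = p′} {r = r} e f = ≋-trans (*P-congˡ r e) (*P-congʳ p′ f)

*P-distribˡ : ∀ p r s → p *P (r +P s) ≋ p *P r +P p *P s
*P-distribˡ []      r s = ≋-refl
*P-distribˡ (a ∷ p) r s =
  ≋-trans (+P-cong (scale-distribˡ a r s) (∷-cong refl (*P-distribˡ p r s)))
          (+P-interchange (scale a r) (scale a s) (+ 0 ∷ p *P r) (+ 0 ∷ p *P s))

*P-distribʳ : ∀ r p p′ → (p +P p′) *P r ≋ p *P r +P p′ *P r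
*P-distribʳ r []      p′       = ≋-refl
*P-distribʳ r (a ∷ p) []       = ≋-sym (+P-identityʳ _)
*P-distribʳ r (a ∷ p) (b ∷ p′) =
  ≋-trans (+P-cong (scale-distribʳ a b r) (∷-cong refl (*P-distribʳ r p p′)))
          (+P-interchange (scale a r) (scale b r) (+ 0 ∷ p *P r) (+ 0 ∷ p′ *P r))

scale-*P : ∀ c p r → scale c p *P r ≋ scale c (p *P r)
scale-*P c []      r = ≋-refl
scale-*P c (a ∷ p) r =
  ≋-trans (+P-cong (≋-sym (scale-scale c a r)) (∷-cong (sym (ℤ.*-zeroʳ c)) (scale-*P c p r)))
          (≋-sym (scale-distribˡ c (scale a r) (+ 0 ∷ p *P r)))

negP-*P : ∀ p r → negP p *P r ≋ negP (p *P r)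
negP-*P = scale-*P -[1+ 0 ]

0∷-*P : ∀ p r → (+ 0 ∷ p) *P r ≋ + 0 ∷ p *P r
0∷-*P p r = +P-cong (scale-zero r) ≋-refl

*P-assoc : ∀ p r s → (p *P r) *P s ≋ p *P (r *P s)
*P-assoc []      r s = ≋-refl
*P-assoc (a ∷ p) r s =
  ≋-trans (*P-distribʳ s (scale a r) (+ 0 ∷ p *P r))
          (+P-cong (scale-*P a r s) (≋-trans (0∷-*P (p *P r) s) (∷-cong refl (*P-assoc p r s))))

*P-∷ʳ : ∀ r a p → r *P (a ∷ p) ≋ scale a r +P (+ 0 ∷ r *P p)
*P-∷ʳ []      a p = ≋-sym (0∷-zero ≋-refl)
*P-∷ʳ (b ∷ r) a p =
  ≋-trans (∷-cong refl (+P-cong {scale b p} ≋-refl (*P-∷ʳ r a p)))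
  (∷-cong (cong (_+ℤ + 0) (ℤ.*-comm b a))
    (≋-trans (≋-sym (+P-assoc (scale b p) (scale a r) _))
    (≋-trans (+P-cong (+P-comm (scale b p) (scale a r)) ≋-refl) (+P-assoc (scale a r) (scale b p) _))))

*P-comm : ∀ p r → p *P r ≋ r *P p
*P-comm []      r = ≋-sym (*P-zeroʳ r)
*P-comm (a ∷ p) r = ≋-trans (+P-cong {scale a r} ≋-refl (∷-cong refl (*P-comm p r))) (≋-sym (*P-∷ʳ r a p))

*P-identityˡ : ∀ p → oneP *P p ≋ p
*P-identityˡ p = ≋-trans (+P-cong (scale-one p) (0∷-zero {[]} ≋-refl)) (+P-identityʳ p)

*P-swap : ∀ p r s → p *P (r *P s) ≋ r *P (p *P s)
*P-swap p r s = ≋-trans (≋-sym (*P-assoc p r s)) (≋-trans (*P-congˡ s (*P-comm p r)) (*P-assoc r p s))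

*P-≋[]ʳ : ∀ p {r} → r ≋ [] → p *P r ≋ []
*P-≋[]ʳ p r≋[] = ≋-trans (*P-congʳ p r≋[]) (*P-zeroʳ p)

+P-≋[]ʳ : ∀ p {r} → r ≋ [] → p +P r ≋ p
+P-≋[]ʳ p r≋[] = ≋-trans (+P-cong ≋-refl r≋[]) (+P-identityʳ p)

coeff₀-*P : ∀ p r → coeff (p *P r) 0 ≡ coeff p 0 *ℤ coeff r 0
coeff₀-*P []      r = sym (ℤ.*-zeroˡ (coeff r 0))
coeff₀-*P (a ∷ p) r = trans (coeff-+P (scale a r) (+ 0 ∷ p *P r) 0)
                            (trans (ℤ.+-identityʳ _) (coeff-scale a r 0))

coeff₀-unitˡ : ∀ {p} → coeff p 0 ≡ + 1 → ∀ r → coeff (p *P r) 0 ≡ coeff r 0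
coeff₀-unitˡ {p} p₀≡1 r = trans (coeff₀-*P p r) (trans (cong (_*ℤ coeff r 0) p₀≡1) (ℤ.*-identityˡ (coeff r 0)))

ℤ[q]-isCommutativeRing : IsCommutativeRing _≋_ _+P_ _*P_ negP [] oneP
ℤ[q]-isCommutativeRing = record
  { isRing = record
    { +-isAbelianGroup = record
      { isGroup = record
        { isMonoid = record
          { isSemigroup = record
            { isMagma = record { isEquivalence = ≋-isEquivalence ; ∙-cong = +P-cong }
            ; assoc = +P-assoc }
          ; identity = (λ _ → ≋-refl) , +P-identityʳ }
        ; inverse = (λ p → ≋-trans (+P-comm (negP p) p) (negP-inverseʳ p)) , negP-inverseʳ
        ; ⁻¹-cong = negP-cong }
      ; comm = +P-comm }
    ; *-cong = *P-cong
    ; *-assoc = *P-assoc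
    ; *-identity = *P-identityˡ , λ p → ≋-trans (*P-comm p oneP) (*P-identityˡ p)
    ; distrib = *P-distribˡ , *P-distribʳ }
  ; *-comm = *P-comm }

ℤ[q]-commutativeRing : CommutativeRing 0ℓ 0ℓ
ℤ[q]-commutativeRing = record { isCommutativeRing = ℤ[q]-isCommutativeRing }

ℤ[q] : AlmostCommutativeRing 0ℓ 0ℓ
ℤ[q] = fromCommutativeRing ℤ[q]-commutativeRing isZero
  where
  isZero : ∀ p → Maybe ([] ≋ p)
  isZero []            = just ≋-refl
  isZero (+ zero ∷ p) with isZero p
  ... | just e  = just (≋-sym (0∷-zero (≋-sym e)))
  ... | nothing = nothing
  isZero (_ ∷ _)       = nothing

open SetoidReasoning (CommutativeRing.setoid ℤ[q]-commutativeRing)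

-- Powers of q and the sums E and O

infixl 6 _-P_
_-P_ : Poly → Poly → Poly
p -P r = p +P negP r

-P-≋[]ʳ : ∀ p {r} → r ≋ [] → p -P r ≋ p
-P-≋[]ʳ p r≋[] = +P-≋[]ʳ p (negP-cong r≋[])

q q² : Poly
q  = + 0 ∷ oneP
q² = q *P q

infix 8 q^_ q²^_
q^_ : ℕ → Poly
q^ zero    = oneP
q^ (suc n) = q *P q^ n

q²^_ : ℕ → Poly
q²^ zero    = oneP
q²^ (suc n) = q² *P q²^ n

double : ℕ → ℕ
double n = n + n

double-suc : ∀ n → double (suc n) ≡ suc (suc (double n))
double-suc n = cong suc (+-suc n n)

q*P≋0∷ : ∀ p → q *P p ≋ + 0 ∷ p
q*P≋0∷ p = ≋-trans (0∷-*P oneP p) (∷-cong refl (*P-identityˡ p))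

q*P-cancel : ∀ {p r} → q *P p ≋ q *P r → p ≋ r
q*P-cancel {p} {r} e with ≋-trans (≋-sym (q*P≋0∷ p)) (≋-trans e (q*P≋0∷ r))
... | mk≋ f = mk≋ λ i → f (suc i)

coeff₀≡0⇒q-multiple : ∀ r → coeff r 0 ≡ + 0 → Σ Poly λ s → r ≋ q *P s
coeff₀≡0⇒q-multiple []      _   = [] , ≋-sym (*P-zeroʳ q)
coeff₀≡0⇒q-multiple (a ∷ s) a≡0 = s , ≋-trans (∷-cong a≡0 ≋-refl) (≋-sym (q*P≋0∷ s))

q^-cong : ∀ {m n} → m ≡ n → q^ m ≋ q^ n
q^-cong refl = ≋-refl

q^-+ : ∀ m n → q^ (m + n) ≋ q^ m *P q^ n
q^-+ zero    n = ≋-sym (*P-identityˡ (q^ n))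
q^-+ (suc m) n = ≋-trans (*P-congʳ q (q^-+ m n)) (≋-sym (*P-assoc q (q^ m) (q^ n)))

q^-double : ∀ n → q^ (double n) ≋ q²^ n
q^-double zero    = ≋-refl
q^-double (suc n) = begin
  q^ (suc n + suc n)        ≈⟨ q^-+ (suc n) (suc n) ⟩
  q^ (suc n) *P q^ (suc n)  ≈⟨ exchange q (q^ n) ⟩
  q² *P (q^ n *P q^ n)      ≈⟨ *P-congʳ q² (≋-sym (q^-+ n n)) ⟩
  q² *P q^ (double n)         ≈⟨ *P-congʳ q² (q^-double n) ⟩
  q²^ (suc n)               ∎
  where
  exchange : ∀ q a → (q *P a) *P (q *P a) ≋ (q *P q) *P (a *P a)
  exchange = solve-∀ ℤ[q]

q^-quadruple : ∀ t → q^ (double (double t)) ≋ q²^ t *P q²^ t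
q^-quadruple t = ≋-trans (q^-+ (double t) (double t)) (*P-cong (q^-double t) (q^-double t))

qpow≋q^ : ∀ k → qpow k ≋ q^ k
qpow≋q^ zero    = ≋-refl
qpow≋q^ (suc k) = ≋-trans (∷-cong refl (qpow≋q^ k)) (≋-sym (q*P≋0∷ (q^ k)))

-- E N x y and O N x y are the sums E_N(x,y) and O_N(x,y) (see E-sum and O-sum); the clauses are the
-- q-Pascal rule [N+1,j] = [N,j-1] + qʲ [N,j].
mutual
  E : ℕ → Poly → Poly → Poly
  E zero    x y = oneP
  E (suc N) x y = y *P E N (q² *P x) y -P x *P O N (q² *P x) y

  O : ℕ → Poly → Poly → Poly
  O zero    x y = []
  O (suc N) x y = y *P E N x y +P (q *P y) *P O N (q² *P x) y

-- The other q-Pascal rule [N+1,j] = q^(N+1-j) [N,j-1] + [N,j]; E-suc-dual is multiplied by q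
-- so that no q^(N-1) appears.
mutual
  E-suc-dual : ∀ N x y → q *P E (suc N) x y ≋ q *P (y *P E N x y) -P q^ N *P (x *P O N x y)
  E-suc-dual zero x y = base q x y
    where
    base : ∀ q x y → q *P (y *P oneP -P x *P []) ≋ q *P (y *P oneP) -P oneP *P (x *P [])
    base = solve-∀ ℤ[q]
  E-suc-dual (suc N) x y = begin
    q *P (y *P E (suc N) (q² *P x) y -P x *P O (suc N) (q² *P x) y)
      ≈⟨ regroup q x y _ _ ⟩
    y *P (q *P E (suc N) (q² *P x) y) -P (q *P x) *P O (suc N) (q² *P x) y
      ≈⟨ +P-cong (*P-congʳ y (E-suc-dual N (q² *P x) y))
                 (negP-cong (*P-congʳ (q *P x) (O-suc-dual N x y))) ⟩
    y *P (q *P (y *P E N (q² *P x) y) -P q^ N *P ((q² *P x) *P O N (q² *P x) y))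
      -P (q *P x) *P (q^ N *P (y *P E N x y) +P y *P O N (q² *P x) y)
      ≈⟨ expand q x y (q^ N) _ _ _ ⟩
    q *P (y *P E (suc N) x y) -P q^ (suc N) *P (x *P O (suc N) x y)
      ∎
    where
    regroup : ∀ q x y e o → q *P (y *P e -P x *P o) ≋ y *P (q *P e) -P (q *P x) *P o
    regroup = solve-∀ ℤ[q]
    expand : ∀ q x y a e₁ o₁ e₀ →
      y *P (q *P (y *P e₁) -P a *P ((q *P q *P x) *P o₁)) -P (q *P x) *P (a *P (y *P e₀) +P y *P o₁)
      ≋ q *P (y *P (y *P e₁ -P x *P o₁)) -P (q *P a) *P (x *P (y *P e₀ +P (q *P y) *P o₁))
    expand = solve-∀ ℤ[q]

  O-suc-dual : ∀ N x y → O (suc N) (q² *P x) y ≋ q^ N *P (y *P E N x y) +P y *P O N (q² *P x) y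
  O-suc-dual zero x y = base q x y
    where
    base : ∀ q x y → y *P oneP +P (q *P y) *P [] ≋ oneP *P (y *P oneP) +P y *P []
    base = solve-∀ ℤ[q]
  O-suc-dual (suc N) x y = begin
    y *P E (suc N) (q² *P x) y +P (q *P y) *P O (suc N) (q² *P (q² *P x)) y
      ≈⟨ +P-cong (*P-congʳ y E-suc-at-q²x) (*P-congʳ (q *P y) (O-suc-dual N (q² *P x) y)) ⟩
    y *P (y *P E N (q² *P x) y -P (q^ N *P q) *P (x *P O N (q² *P x) y))
      +P (q *P y) *P (q^ N *P (y *P E N (q² *P x) y) +P y *P O N (q² *P (q² *P x)) y)
      ≈⟨ expand q x y (q^ N) _ _ _ ⟩
    q^ (suc N) *P (y *P E (suc N) x y) +P y *P O (suc N) (q² *P x) y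
      ∎
    where
    cancel-q : ∀ q x y a e o → q *P (y *P e) -P a *P ((q *P q *P x) *P o) ≋ q *P (y *P e -P (a *P q) *P (x *P o))
    cancel-q = solve-∀ ℤ[q]
    E-suc-at-q²x : E (suc N) (q² *P x) y ≋ y *P E N (q² *P x) y -P (q^ N *P q) *P (x *P O N (q² *P x) y)
    E-suc-at-q²x = q*P-cancel (≋-trans (E-suc-dual N (q² *P x) y) (cancel-q q x y (q^ N) _ _))
    expand : ∀ q x y a e₁ o₁ o₂ →
      y *P (y *P e₁ -P (a *P q) *P (x *P o₁)) +P (q *P y) *P (a *P (y *P e₁) +P y *P o₂)
      ≋ (q *P a) *P (y *P (y *P e₁ -P x *P o₁)) +P y *P (y *P e₁ +P (q *P y) *P o₂)
    expand = solve-∀ ℤ[q]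

mutual
  E-homogeneous : ∀ N x y → E N (q² *P x) (q² *P y) ≋ q²^ N *P E N x y
  E-homogeneous zero    x y = ≋-sym (*P-identityˡ oneP)
  E-homogeneous (suc N) x y = begin
    (q² *P y) *P E N (q² *P (q² *P x)) (q² *P y) -P (q² *P x) *P O N (q² *P (q² *P x)) (q² *P y)
      ≈⟨ +P-cong (*P-congʳ (q² *P y) (E-homogeneous N (q² *P x) y))
                 (negP-cong (*P-congʳ (q² *P x) (O-homogeneous N (q² *P x) y))) ⟩
    (q² *P y) *P (q²^ N *P E N (q² *P x) y) -P (q² *P x) *P (q²^ N *P O N (q² *P x) y)
      ≈⟨ factor q² x y (q²^ N) _ _ ⟩
    q²^ (suc N) *P E (suc N) x y
      ∎
    where
    factor : ∀ s x y h e o → (s *P y) *P (h *P e) -P (s *P x) *P (h *P o) ≋ (s *P h) *P (y *P e -P x *P o)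
    factor = solve-∀ ℤ[q]

  O-homogeneous : ∀ N x y → O N (q² *P x) (q² *P y) ≋ q²^ N *P O N x y
  O-homogeneous zero    x y = ≋-sym (*P-zeroʳ oneP)
  O-homogeneous (suc N) x y = begin
    (q² *P y) *P E N (q² *P x) (q² *P y) +P (q *P (q² *P y)) *P O N (q² *P (q² *P x)) (q² *P y)
      ≈⟨ +P-cong (*P-congʳ (q² *P y) (E-homogeneous N x y))
                 (*P-congʳ (q *P (q² *P y)) (O-homogeneous N (q² *P x) y)) ⟩
    (q² *P y) *P (q²^ N *P E N x y) +P (q *P (q² *P y)) *P (q²^ N *P O N (q² *P x) y)
      ≈⟨ factor q² q y (q²^ N) _ _ ⟩
    q²^ (suc N) *P O (suc N) x y
      ∎
    where
    factor : ∀ s q y h e o → (s *P y) *P (h *P e) +P (q *P (s *P y)) *P (h *P o) ≋ (s *P h) *P (y *P e +P (q *P y) *P o)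
    factor = solve-∀ ℤ[q]

-- E and O as explicit sums

sumP-cong : ∀ K {f g : ℕ → Poly} → (∀ k → f k ≋ g k) → sumP K f ≋ sumP K g
sumP-cong zero    f≋g = ≋-refl
sumP-cong (suc K) f≋g = +P-cong (sumP-cong K f≋g) (f≋g K)

sumP-≋[] : ∀ K {f : ℕ → Poly} → (∀ k → f k ≋ []) → sumP K f ≋ []
sumP-≋[] zero    f≋[] = ≋-refl
sumP-≋[] (suc K) f≋[] = +P-cong (sumP-≋[] K f≋[]) (f≋[] K)

sumP-shift : ∀ K (f : ℕ → Poly) → sumP (suc K) f ≋ f 0 +P sumP K (λ k → f (suc k))
sumP-shift zero    f = ≋-sym (+P-identityʳ (f 0))
sumP-shift (suc K) f = ≋-trans (+P-cong (sumP-shift K f) ≋-refl) (+P-assoc (f 0) _ (f (suc K)))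

sumP-*ˡ : ∀ K u (f : ℕ → Poly) → sumP K (λ k → u *P f k) ≋ u *P sumP K f
sumP-*ˡ zero    u f = ≋-sym (*P-zeroʳ u)
sumP-*ˡ (suc K) u f = ≋-trans (+P-cong (sumP-*ˡ K u f) ≋-refl) (≋-sym (*P-distribˡ u (sumP K f) (f K)))

sumP-linear : ∀ K u v (f g : ℕ → Poly) → sumP K (λ k → u *P f k +P v *P g k) ≋ u *P sumP K f +P v *P sumP K g
sumP-linear zero    u v f g = ≋-sym (+P-cong (*P-zeroʳ u) (*P-zeroʳ v))
sumP-linear (suc K) u v f g = ≋-trans (+P-cong (sumP-linear K u v f g) ≋-refl) (regroup u v (sumP K f) (sumP K g) (f K) (g K))
  where
  regroup : ∀ u v s t x y → (u *P s +P v *P t) +P (u *P x +P v *P y) ≋ u *P (s +P x) +P v *P (t +P y)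
  regroup = solve-∀ ℤ[q]

qbin-zeroth : ∀ n → qbin n 0 ≡ oneP
qbin-zeroth zero    = refl
qbin-zeroth (suc n) = refl

qbin-vanishes : ∀ n k → n < k → qbin n k ≋ []
qbin-vanishes zero    (suc k) _         = ≋-refl
qbin-vanishes (suc n) (suc k) (s≤s n<k) =
  +P-cong (qbin-vanishes n k n<k) (*P-≋[]ʳ (qpow (suc k)) (qbin-vanishes n (suc k) (m<n⇒m<1+n n<k)))

sign : ℕ → Poly
sign zero    = oneP
sign (suc k) = negP (sign k)

signP≋sign*P : ∀ k p → signP k p ≋ sign k *P p
signP≋sign*P zero    p = ≋-sym (*P-identityˡ p)
signP≋sign*P (suc k) p = ≋-trans (negP-cong (signP≋sign*P k p)) (≋-sym (negP-*P (sign k) p))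

exponent : ℕ → ℕ → ℕ → ℕ → ℕ
exponent N a b k = k * (k ∸ 1) + double a * k + double b * (N ∸ k)

E-term O-term : ℕ → ℕ → ℕ → ℕ → Poly
E-term N a b k = sign k *P (q^ (exponent N a b k) *P qbin N (double k))
O-term N a b k = sign k *P (q^ (exponent N a b k) *P qbin N (suc (double k)))

suc-∸ : ∀ {N k} → k ≤ N → suc N ∸ k ≡ suc (N ∸ k)
suc-∸ = +-∸-assoc 1

suc-pronic : ∀ k → suc k * k ≡ k * (k ∸ 1) + double k
suc-pronic zero    = refl
suc-pronic (suc k) = identity k
  where
  identity : ∀ k → (2 + k) * (1 + k) ≡ (1 + k) * k + ((1 + k) + (1 + k))
  identity = ℕ-solve-∀

exponent-zero-suc : ∀ N a b → exponent (suc N) a b 0 ≡ double b + exponent N (suc a) b 0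
exponent-zero-suc N a b = identity N a b
  where
  identity : ∀ N a b → 0 + (a + a) * 0 + (b + b) * (1 + N) ≡ (b + b) + (0 + ((1 + a) + (1 + a)) * 0 + (b + b) * N)
  identity = ℕ-solve-∀

exponent-suc-suc : ∀ N a b k → exponent (suc N) a b (suc k) ≡ double a + exponent N (suc a) b k
exponent-suc-suc N a b k =
  trans (cong (λ z → z + double a * suc k + double b * (N ∸ k)) (suc-pronic k)) (identity (k * (k ∸ 1)) k a (double b * (N ∸ k)))
  where
  identity : ∀ p k a d → (p + (k + k)) + (a + a) * (1 + k) + d ≡ (a + a) + (p + ((1 + a) + (1 + a)) * k + d)
  identity = ℕ-solve-∀

exponent-suc-N : ∀ N a b {k} → k ≤ N → exponent (suc N) a b k ≡ double b + exponent N a b k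
exponent-suc-N N a b {k} k≤N =
  trans (cong (λ d → k * (k ∸ 1) + double a * k + double b * d) (suc-∸ k≤N)) (identity (k * (k ∸ 1) + double a * k) b (N ∸ k))
  where
  identity : ∀ p b d → p + (b + b) * (1 + d) ≡ (b + b) + (p + (b + b) * d)
  identity = ℕ-solve-∀

exponent-suc-N-a : ∀ N a b {k} → k ≤ N → exponent (suc N) a b k + suc (double k) ≡ suc (double b + exponent N (suc a) b k)
exponent-suc-N-a N a b {k} k≤N =
  trans (cong (λ d → k * (k ∸ 1) + double a * k + double b * d + suc (double k)) (suc-∸ k≤N)) (identity (k * (k ∸ 1)) k a b (N ∸ k))
  where
  identity : ∀ p k a b d → p + (a + a) * k + (b + b) * (1 + d) + (1 + (k + k)) ≡ 1 + ((b + b) + (p + ((1 + a) + (1 + a)) * k + (b + b) * d))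
  identity = ℕ-solve-∀

exponent-suc-suc-a : ∀ N a b {k} → suc k ≤ N → exponent (suc N) a b (suc k) + double (suc k) ≡ double b + exponent N (suc a) b (suc k)
exponent-suc-suc-a (suc N) a b {k} (s≤s k≤N) =
  trans (cong (λ d → suc k * k + double a * suc k + double b * d + double (suc k)) (suc-∸ k≤N)) (identity k a b (N ∸ k))
  where
  identity : ∀ k a b d → (1 + k) * k + (a + a) * (1 + k) + (b + b) * (1 + d) + ((1 + k) + (1 + k))
                         ≡ (b + b) + ((1 + k) * k + ((1 + a) + (1 + a)) * (1 + k) + (b + b) * d)
  identity = ℕ-solve-∀

factor-q^ : ∀ d k {e e′} Q → e ≡ d + e′ → sign k *P (q^ e *P Q) ≋ q^ d *P (sign k *P (q^ e′ *P Q))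
factor-q^ d k {e′ = e′} Q refl =
  ≋-trans (*P-congʳ (sign k) (*P-congˡ Q (q^-+ d e′))) (rearrange (sign k) (q^ d) (q^ e′) Q)
  where
  rearrange : ∀ s a b c → s *P ((a *P b) *P c) ≋ a *P (s *P (b *P c))
  rearrange = solve-∀ ℤ[q]

-- The exponent identities behind the recurrences hold only where N ∸ k is not truncated;
-- elsewhere the Gaussian binomial vanishes.
factor-q^-qbin : ∀ d k {N j e e′} → (j ≤ N → e ≡ d + e′) →
  sign k *P (q^ e *P qbin N j) ≋ q^ d *P (sign k *P (q^ e′ *P qbin N j))
factor-q^-qbin d k {N} {j} {e} {e′} e≡ with j ≤? N
... | yes j≤N = factor-q^ d k (qbin N j) (e≡ j≤N)
... | no  j≰N = ≋-trans (*P-≋[]ʳ (sign k) (*P-≋[]ʳ (q^ e) vanishes))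
                        (≋-sym (*P-≋[]ʳ (q^ d) (*P-≋[]ʳ (sign k) (*P-≋[]ʳ (q^ e′) vanishes))))
  where
  vanishes : qbin N j ≋ []
  vanishes = qbin-vanishes N j (≰⇒> j≰N)

term-pascal : ∀ s e N j → s *P (q^ e *P qbin (suc N) (suc j)) ≋ s *P (q^ e *P qbin N j) +P s *P (q^ (e + suc j) *P qbin N (suc j))
term-pascal s e N j = begin
  s *P (q^ e *P (qbin N j +P qpow (suc j) *P qbin N (suc j)))
    ≈⟨ *P-congʳ s (*P-congʳ (q^ e) (+P-cong ≋-refl (*P-congˡ (qbin N (suc j)) (qpow≋q^ (suc j))))) ⟩
  s *P (q^ e *P (qbin N j +P q^ (suc j) *P qbin N (suc j)))
    ≈⟨ expand s (q^ e) (q^ (suc j)) (qbin N j) (qbin N (suc j)) ⟩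
  s *P (q^ e *P qbin N j) +P s *P ((q^ e *P q^ (suc j)) *P qbin N (suc j))
    ≈⟨ +P-cong ≋-refl (*P-congʳ s (*P-congˡ (qbin N (suc j)) (≋-sym (q^-+ e (suc j))))) ⟩
  s *P (q^ e *P qbin N j) +P s *P (q^ (e + suc j) *P qbin N (suc j))
    ∎
  where
  expand : ∀ s w u Q₁ Q₂ → s *P (w *P (Q₁ +P u *P Q₂)) ≋ s *P (w *P Q₁) +P s *P ((w *P u) *P Q₂)
  expand = solve-∀ ℤ[q]

E-term-suc-zero : ∀ N a b → E-term (suc N) a b 0 ≋ q²^ b *P E-term N (suc a) b 0
E-term-suc-zero N a b rewrite qbin-zeroth N =
  ≋-trans (factor-q^ (double b) 0 oneP (exponent-zero-suc N a b)) (*P-congˡ _ (q^-double b))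

E-term-suc-suc : ∀ N a b k →
  E-term (suc N) a b (suc k) ≋ q²^ b *P E-term N (suc a) b (suc k) +P negP (q²^ a) *P O-term N (suc a) b k
E-term-suc-suc N a b k = begin
  E-term (suc N) a b (suc k)
    ≈⟨ term-pascal s′ e N (k + suc k) ⟩
  s′ *P (q^ e *P qbin N (k + suc k)) +P s′ *P (q^ (e + double (suc k)) *P qbin N (double (suc k)))
    ≈⟨ +P-cong (≋-reflexive-qbin (+-suc k k)) ≋-refl ⟩
  s′ *P (q^ e *P qbin N (suc (double k))) +P s′ *P (q^ (e + double (suc k)) *P qbin N (double (suc k)))
    ≈⟨ +P-cong (factor-q^ (double a) (suc k) _ (exponent-suc-suc N a b k))
               (factor-q^-qbin (double b) (suc k) (λ 2k+2≤N → exponent-suc-suc-a N a b (≤-trans (s≤s (m≤m+n k (suc k))) 2k+2≤N))) ⟩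
  q^ (double a) *P (s′ *P (q^ (exponent N (suc a) b k) *P qbin N (suc (double k))))
    +P q^ (double b) *P E-term N (suc a) b (suc k)
    ≈⟨ +P-cong (*P-congˡ _ (q^-double a)) (*P-congˡ _ (q^-double b)) ⟩
  q²^ a *P (s′ *P (q^ (exponent N (suc a) b k) *P qbin N (suc (double k)))) +P q²^ b *P E-term N (suc a) b (suc k)
    ≈⟨ reorder (q²^ a) (sign k) _ (q²^ b *P E-term N (suc a) b (suc k)) ⟩
  q²^ b *P E-term N (suc a) b (suc k) +P negP (q²^ a) *P O-term N (suc a) b k
    ∎
  where
  s′ : Poly
  s′ = sign (suc k)
  e : ℕ
  e = exponent (suc N) a b (suc k)
  ≋-reflexive-qbin : ∀ {j j′} → j ≡ j′ → s′ *P (q^ e *P qbin N j) ≋ s′ *P (q^ e *P qbin N j′)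
  ≋-reflexive-qbin refl = ≋-refl
  reorder : ∀ x s t u → x *P (negP s *P t) +P u ≋ u +P negP x *P (s *P t)
  reorder = solve-∀ ℤ[q]

O-term-suc : ∀ N a b k →
  O-term (suc N) a b k ≋ q²^ b *P E-term N a b k +P (q *P q²^ b) *P O-term N (suc a) b k
O-term-suc N a b k = begin
  O-term (suc N) a b k
    ≈⟨ term-pascal (sign k) e N (double k) ⟩
  sign k *P (q^ e *P qbin N (double k)) +P sign k *P (q^ (e + suc (double k)) *P qbin N (suc (double k)))
    ≈⟨ +P-cong (factor-q^-qbin (double b) k (λ 2k≤N → exponent-suc-N N a b (≤-trans (m≤m+n k k) 2k≤N)))
               (factor-q^-qbin (suc (double b)) k (λ 2k+1≤N → exponent-suc-N-a N a b (≤-trans (m≤m+n k k) (≤-trans (n≤1+n _) 2k+1≤N)))) ⟩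
  q^ (double b) *P E-term N a b k +P q^ (suc (double b)) *P O-term N (suc a) b k
    ≈⟨ +P-cong (*P-congˡ _ (q^-double b)) (*P-congˡ _ (*P-congʳ q (q^-double b))) ⟩
  q²^ b *P E-term N a b k +P (q *P q²^ b) *P O-term N (suc a) b k
    ∎
  where
  e : ℕ
  e = exponent (suc N) a b k

E-sum-suc : ∀ N a b K →
  sumP (suc K) (E-term (suc N) a b) ≋ q²^ b *P sumP (suc K) (E-term N (suc a) b) -P q²^ a *P sumP K (O-term N (suc a) b)
E-sum-suc N a b K = begin
  sumP (suc K) (E-term (suc N) a b)
    ≈⟨ sumP-shift K (E-term (suc N) a b) ⟩
  E-term (suc N) a b 0 +P sumP K (λ k → E-term (suc N) a b (suc k))
    ≈⟨ +P-cong (E-term-suc-zero N a b) (sumP-cong K (E-term-suc-suc N a b)) ⟩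
  y *P E′ 0 +P sumP K (λ k → y *P E′ (suc k) +P negP x *P O′ k)
    ≈⟨ +P-cong ≋-refl (sumP-linear K y (negP x) (λ k → E′ (suc k)) O′) ⟩
  y *P E′ 0 +P (y *P sumP K (λ k → E′ (suc k)) +P negP x *P sumP K O′)
    ≈⟨ regroup y x (E′ 0) _ _ ⟩
  y *P (E′ 0 +P sumP K (λ k → E′ (suc k))) -P x *P sumP K O′
    ≈⟨ +P-cong (*P-congʳ y (≋-sym (sumP-shift K E′))) ≋-refl ⟩
  y *P sumP (suc K) E′ -P x *P sumP K O′
    ∎
  where
  x y : Poly
  x = q²^ a
  y = q²^ b
  E′ O′ : ℕ → Poly
  E′ = E-term N (suc a) b
  O′ = O-term N (suc a) b
  regroup : ∀ y x e s t → y *P e +P (y *P s +P negP x *P t) ≋ y *P (e +P s) -P x *P t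
  regroup = solve-∀ ℤ[q]

O-sum-suc : ∀ N a b K →
  sumP K (O-term (suc N) a b) ≋ q²^ b *P sumP K (E-term N a b) +P (q *P q²^ b) *P sumP K (O-term N (suc a) b)
O-sum-suc N a b K = ≋-trans (sumP-cong K (O-term-suc N a b)) (sumP-linear K (q²^ b) (q *P q²^ b) (E-term N a b) (O-term N (suc a) b))

mutual
  E-sum : ∀ N a b K → N < double K → E N (q²^ a) (q²^ b) ≋ sumP K (E-term N a b)
  E-sum zero a b (suc K) _ = ≋-sym (begin
    sumP (suc K) (E-term 0 a b)
      ≈⟨ sumP-shift K (E-term 0 a b) ⟩
    E-term 0 a b 0 +P sumP K (λ k → E-term 0 a b (suc k))
      ≈⟨ +P-≋[]ʳ _ (sumP-≋[] K (λ k → *P-≋[]ʳ (sign (suc k)) (*P-zeroʳ (q^ (exponent 0 a b (suc k)))))) ⟩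
    oneP *P (q^ (exponent 0 a b 0) *P oneP)
      ≈⟨ *P-congʳ oneP (*P-congˡ oneP (q^-cong (exponent-at-origin a b))) ⟩
    oneP
      ∎)
    where
    exponent-at-origin : ∀ a b → exponent 0 a b 0 ≡ 0
    exponent-at-origin a b = cong₂ _+_ (*-zeroʳ (double a)) (*-zeroʳ (double b))
  E-sum (suc N) a b (suc K) (s≤s N<2K+1) = begin
    q²^ b *P E N (q²^ (suc a)) (q²^ b) -P q²^ a *P O N (q²^ (suc a)) (q²^ b)
      ≈⟨ +P-cong (*P-congʳ (q²^ b) (E-sum N (suc a) b (suc K) (m<n⇒m<1+n N<2K+1)))
                 (negP-cong (*P-congʳ (q²^ a) (O-sum N (suc a) b K (subst (N <_) (+-suc K K) N<2K+1)))) ⟩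
    q²^ b *P sumP (suc K) (E-term N (suc a) b) -P q²^ a *P sumP K (O-term N (suc a) b)
      ≈⟨ ≋-sym (E-sum-suc N a b K) ⟩
    sumP (suc K) (E-term (suc N) a b)
      ∎

  O-sum : ∀ N a b K → N < suc (double K) → O N (q²^ a) (q²^ b) ≋ sumP K (O-term N a b)
  O-sum zero    a b K _ = ≋-sym (sumP-≋[] K (λ k → *P-≋[]ʳ (sign k) (*P-zeroʳ (q^ (exponent 0 a b k)))))
  O-sum (suc N) a b K (s≤s N<2K) = begin
    q²^ b *P E N (q²^ a) (q²^ b) +P (q *P q²^ b) *P O N (q²^ (suc a)) (q²^ b)
      ≈⟨ +P-cong (*P-congʳ (q²^ b) (E-sum N a b K N<2K)) (*P-congʳ (q *P q²^ b) (O-sum N (suc a) b K (m<n⇒m<1+n N<2K))) ⟩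
    q²^ b *P sumP K (E-term N a b) +P (q *P q²^ b) *P sumP K (O-term N (suc a) b)
      ≈⟨ ≋-sym (O-sum-suc N a b K) ⟩
    sumP K (O-term (suc N) a b)
      ∎

-- Divisibility up to a power of q

infix 4 _∣q_
record _∣q_ (D X : Poly) : Set where
  constructor divides-q
  field
    power    : ℕ
    cofactor : Poly
    equation : q^ power *P X ≋ D *P cofactor

module _ {D : Poly} where

  ∣q-resp : ∀ {X Y} → X ≋ Y → D ∣q X → D ∣q Y
  ∣q-resp X≋Y (divides-q k r e) = divides-q k r (≋-trans (*P-congʳ (q^ k) (≋-sym X≋Y)) e)

  ∣q-multiple : ∀ r → D ∣q D *P r
  ∣q-multiple r = divides-q 0 r (*P-identityˡ (D *P r))

  ∣q-zero : D ∣q []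
  ∣q-zero = ∣q-resp (*P-zeroʳ D) (∣q-multiple [])

  ∣q-+ : ∀ {X Y} → D ∣q X → D ∣q Y → D ∣q X +P Y
  ∣q-+ {X} {Y} (divides-q k r e) (divides-q l s f) = divides-q (k + l) (q^ l *P r +P q^ k *P s) (begin
    q^ (k + l) *P (X +P Y)                  ≈⟨ *P-congˡ (X +P Y) (q^-+ k l) ⟩
    (q^ k *P q^ l) *P (X +P Y)              ≈⟨ spread (q^ k) (q^ l) X Y ⟩
    q^ l *P (q^ k *P X) +P q^ k *P (q^ l *P Y) ≈⟨ +P-cong (*P-congʳ (q^ l) e) (*P-congʳ (q^ k) f) ⟩
    q^ l *P (D *P r) +P q^ k *P (D *P s)    ≈⟨ gather (q^ k) (q^ l) D r s ⟩
    D *P (q^ l *P r +P q^ k *P s)           ∎)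
    where
    spread : ∀ a b x y → (a *P b) *P (x +P y) ≋ b *P (a *P x) +P a *P (b *P y)
    spread = solve-∀ ℤ[q]
    gather : ∀ a b d r s → b *P (d *P r) +P a *P (d *P s) ≋ d *P (b *P r +P a *P s)
    gather = solve-∀ ℤ[q]

  ∣q-*ˡ : ∀ Z {X} → D ∣q X → D ∣q Z *P X
  ∣q-*ˡ Z {X} (divides-q k r e) = divides-q k (Z *P r) (begin
    q^ k *P (Z *P X)  ≈⟨ *P-swap (q^ k) Z X ⟩
    Z *P (q^ k *P X)  ≈⟨ *P-congʳ Z e ⟩
    Z *P (D *P r)     ≈⟨ *P-swap Z D r ⟩
    D *P (Z *P r)     ∎)

  ∣q-negP : ∀ {X} → D ∣q X → D ∣q negP X
  ∣q-negP {X} d = ∣q-resp (≋-trans (negP-*P oneP X) (negP-cong (*P-identityˡ X))) (∣q-*ˡ (negP oneP) d)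

  ∣q-− : ∀ {X Y} → D ∣q X → D ∣q Y → D ∣q X -P Y
  ∣q-− dX dY = ∣q-+ dX (∣q-negP dY)

  ∣q-+-cancelˡ : ∀ {X Y} → D ∣q X +P Y → D ∣q X → D ∣q Y
  ∣q-+-cancelˡ {X} {Y} dXY dX = ∣q-resp (difference X Y) (∣q-− dXY dX)
    where
    difference : ∀ x y → (x +P y) -P x ≋ y
    difference = solve-∀ ℤ[q]

  ∣q-+-cancelʳ : ∀ {X Y} → D ∣q X +P Y → D ∣q Y → D ∣q X
  ∣q-+-cancelʳ {X} {Y} dXY = ∣q-+-cancelˡ (∣q-resp (+P-comm X Y) dXY)

  ∣q-negP⁻¹ : ∀ {X} → D ∣q negP X → D ∣q X
  ∣q-negP⁻¹ {X} d = ∣q-resp (negP-involutive X) (∣q-negP d)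
    where
    negP-involutive : ∀ x → negP (negP x) ≋ x
    negP-involutive = solve-∀ ℤ[q]

  ∣q-cancel-q : ∀ {X} → D ∣q q *P X → D ∣q X
  ∣q-cancel-q {X} (divides-q k r e) = divides-q (suc k) r (≋-trans (*P-assoc q (q^ k) X) (≋-trans (*P-swap q (q^ k) X) e))

  ∣q-cancel-q^ : ∀ j {X} → D ∣q q^ j *P X → D ∣q X
  ∣q-cancel-q^ zero    {X} d = ∣q-resp (*P-identityˡ X) d
  ∣q-cancel-q^ (suc j) {X} d = ∣q-cancel-q (∣q-cancel-q^ j (∣q-resp (≋-trans (*P-assoc q (q^ j) X) (*P-swap q (q^ j) X)) d))

  ∣q-cancel-q²^ : ∀ j {X} → D ∣q q²^ j *P X → D ∣q X
  ∣q-cancel-q²^ j {X} d = ∣q-cancel-q^ (double j) (∣q-resp (*P-congˡ X (≋-sym (q^-double j))) d)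

module _ {D : Poly} (D₀≡1 : coeff D 0 ≡ + 1) where

  cofactor-of-q*P : ∀ {X r} → q *P X ≋ D *P r → Σ Poly λ s → X ≋ D *P s
  cofactor-of-q*P {X} {r} e = s , q*P-cancel (≋-trans e (≋-trans (*P-congʳ D r≋q*s) (*P-swap D q s)))
    where
    r₀≡0 : coeff r 0 ≡ + 0
    r₀≡0 = trans (sym (coeff₀-unitˡ {D} D₀≡1 r)) (trans (sym (coeff-≡ e 0)) (coeff-≡ (q*P≋0∷ X) 0))
    s : Poly
    s = proj₁ (coeff₀≡0⇒q-multiple r r₀≡0)
    r≋q*s : r ≋ q *P s
    r≋q*s = proj₂ (coeff₀≡0⇒q-multiple r r₀≡0)

  cofactor-of-q^*P : ∀ k {X r} → q^ k *P X ≋ D *P r → Σ Poly λ s → X ≋ D *P s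
  cofactor-of-q^*P zero    {X} {r} e = r , ≋-trans (≋-sym (*P-identityˡ X)) e
  cofactor-of-q^*P (suc k) {X} {r} e = cofactor-of-q^*P k (proj₂ (cofactor-of-q*P (≋-trans (≋-sym (*P-assoc q (q^ k) X)) e)))

  ∣q⇒∣P : ∀ {X} → D ∣q X → D ∣P X
  ∣q⇒∣P (divides-q k r e) = map₂ coeff-≡ (cofactor-of-q^*P k e)

∏1+q^ : ℕ → Poly
∏1+q^ zero    = oneP
∏1+q^ (suc n) = ∏1+q^ n *P (oneP +P q^ (suc n))

poch≋∏1+q^ : ∀ n → poch (negP (qpow 1)) n ≋ ∏1+q^ n
poch≋∏1+q^ zero    = ≋-refl
poch≋∏1+q^ (suc n) = *P-cong (poch≋∏1+q^ n) (+P-cong {oneP} ≋-refl (≋-trans (negP-negP (qpow 1) (qpow n))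
  (≋-trans (*P-cong (qpow≋q^ 1) (qpow≋q^ n)) (≋-sym (q^-+ 1 n)))))
  where
  negP-negP : ∀ a b → negP (negP a *P b) ≋ a *P b
  negP-negP = solve-∀ ℤ[q]

coeff₀-∏1+q^ : ∀ n → coeff (∏1+q^ n) 0 ≡ + 1
coeff₀-∏1+q^ zero    = refl
coeff₀-∏1+q^ (suc n) = trans (coeff₀-unitˡ {∏1+q^ n} (coeff₀-∏1+q^ n) (oneP +P q *P q^ n))
                             (trans (coeff-+P oneP (q *P q^ n) 0) (cong (+ 1 +ℤ_) (coeff-≡ (q*P≋0∷ (q^ n)) 0)))

∣P-respˡ : ∀ {D D′ X} → D ≋ D′ → D ∣P X → D′ ∣P X
∣P-respˡ {X = X} D≋D′ (r , X≈Dr) = r , coeff-≡ (≋-trans (mk≋ {X} X≈Dr) (*P-congˡ r D≋D′))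

poch-∣P : ∀ n d {X S} → ∏1+q^ n ∣q X → X ≋ q^ d *P S → poch (negP (qpow 1)) n ∣P S
poch-∣P n d {S = S} ∏∣X X≋q^dS =
  ∣P-respˡ {X = S} (≋-sym (poch≋∏1+q^ n)) (∣q⇒∣P (coeff₀-∏1+q^ n) (∣q-cancel-q^ d (∣q-resp X≋q^dS ∏∣X)))

-- Spreading divisibility over the points (q^2a, q^2b)

module Propagation (D : Poly) (M : ℕ) where

  e o : ℕ → ℕ → Poly
  e a b = E M (q²^ a) (q²^ b)
  o a b = O M (q²^ a) (q²^ b)

  -- E-suc-dual and O-suc-dual each tie four of these values together with monomial coefficients,
  -- so any three of them determine the fourth up to cancelling powers of q.
  E-next : ∀ a b → D ∣q e a b → D ∣q o a b → D ∣q o (suc a) b → D ∣q e (suc a) b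
  E-next a b E-here O-here O-suc = ∣q-cancel-q²^ b (∣q-+-cancelʳ
    (∣q-cancel-q (∣q-resp (≋-sym (E-suc-dual M x y)) (∣q-− (∣q-*ˡ q (∣q-*ˡ y E-here)) (∣q-*ˡ (q^ M) (∣q-*ˡ x O-here)))))
    (∣q-negP (∣q-*ˡ x O-suc)))
    where
    x y : Poly
    x = q²^ a
    y = q²^ b

  O-prev : ∀ a b → D ∣q e a b → D ∣q e (suc a) b → D ∣q o (suc a) b → D ∣q o a b
  O-prev a b E-here E-suc O-suc = ∣q-cancel-q²^ a (∣q-cancel-q^ M (∣q-negP⁻¹ (∣q-+-cancelˡ
    (∣q-resp (E-suc-dual M x y) (∣q-*ˡ q (∣q-− (∣q-*ˡ y E-suc) (∣q-*ˡ x O-suc))))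
    (∣q-*ˡ q (∣q-*ˡ y E-here)))))
    where
    x y : Poly
    x = q²^ a
    y = q²^ b

  O-next : ∀ a b → D ∣q e a b → D ∣q e (suc a) b → D ∣q o (suc a) b → D ∣q o (suc (suc a)) b
  O-next a b E-here E-suc O-suc = ∣q-cancel-q²^ b (∣q-cancel-q (∣q-resp (*P-assoc q y _)
    (∣q-+-cancelˡ (∣q-resp (≋-sym (O-suc-dual M x y)) (∣q-+ (∣q-*ˡ (q^ M) (∣q-*ˡ y E-here)) (∣q-*ˡ y O-suc)))
                  (∣q-*ˡ y E-suc))))
    where
    x y : Poly
    x = q²^ a
    y = q²^ b

  E-prev : ∀ a b → D ∣q e (suc a) b → D ∣q o (suc a) b → D ∣q o (suc (suc a)) b → D ∣q e a b
  E-prev a b E-suc O-suc O-suc-suc = ∣q-cancel-q²^ b (∣q-cancel-q^ M (∣q-+-cancelʳ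
    (∣q-resp (O-suc-dual M x y) (∣q-+ (∣q-*ˡ y E-suc) (∣q-*ˡ (q *P y) O-suc-suc)))
    (∣q-*ˡ y O-suc)))
    where
    x y : Poly
    x = q²^ a
    y = q²^ b

  E-rescale : ∀ a b → D ∣q e a b → D ∣q e (suc a) (suc b)
  E-rescale a b d = ∣q-resp (≋-sym (E-homogeneous M (q²^ a) (q²^ b))) (∣q-*ˡ (q²^ M) d)

  O-rescale : ∀ a b → D ∣q o a b → D ∣q o (suc a) (suc b)
  O-rescale a b d = ∣q-resp (≋-sym (O-homogeneous M (q²^ a) (q²^ b))) (∣q-*ˡ (q²^ M) d)

  record DividesAt (a b : ℕ) : Set where
    field
      E-at-suc : D ∣q e (suc a) b
      E-at     : D ∣q e a b
      O-at-suc : D ∣q o (suc a) b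

  step-a : ∀ {a b} → DividesAt a b → DividesAt (suc a) b
  step-a {a} {b} d = record
    { E-at-suc = E-next (suc a) b E-at-suc O-at-suc O-at-suc-suc
    ; E-at     = E-at-suc
    ; O-at-suc = O-at-suc-suc
    }
    where
    open DividesAt d
    O-at-suc-suc : D ∣q o (suc (suc a)) b
    O-at-suc-suc = O-next a b E-at E-at-suc O-at-suc

  step-b : ∀ {a b} → DividesAt a b → DividesAt a (suc b)
  step-b {a} {b} d = record
    { E-at-suc = E-rescale a b E-at
    ; E-at     = E-prev a (suc b) (E-rescale a b E-at) O-at-suc′ (O-rescale (suc a) b O-at-suc)
    ; O-at-suc = O-at-suc′
    }
    where
    open DividesAt d
    O-at-suc′ : D ∣q o (suc a) (suc b)
    O-at-suc′ = O-rescale a b (O-prev a b E-at E-at-suc O-at-suc)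

  along-b : ∀ {b₀} → DividesAt 0 b₀ → ∀ d → DividesAt 0 (d + b₀)
  along-b s zero    = s
  along-b s (suc d) = step-b (along-b s d)

  along-a : ∀ {b} → DividesAt 0 b → ∀ a → DividesAt a b
  along-a s zero    = s
  along-a s (suc a) = step-a (along-a s a)

  unshift-E : ∀ c {a b} → D ∣q e (c + a) (c + b) → D ∣q e a b
  unshift-E zero    d = d
  unshift-E (suc c) d = unshift-E c (∣q-cancel-q²^ M (∣q-resp (E-homogeneous M _ _) d))

  unshift-O : ∀ c {a b} → D ∣q o (c + a) (c + b) → D ∣q o a b
  unshift-O zero    d = d
  unshift-O (suc c) d = unshift-O c (∣q-cancel-q²^ M (∣q-resp (O-homogeneous M _ _) d))

  -- Moving both arguments by q² only rescales E and O, so the quadrant above (0, b₀) covers everything.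
  divides-everywhere : ∀ {b₀} → DividesAt 0 b₀ → ∀ a b → D ∣q e a b × D ∣q o a b
  divides-everywhere {b₀} s a b =
      unshift-E b₀ (subst (λ c → D ∣q e (b₀ + a) c) (+-comm b b₀) (E-at (reach b)))
    , unshift-O (suc b₀) (subst (λ c → D ∣q o (suc b₀ + a) (suc c)) (+-comm b b₀) (O-at-suc (reach (suc b))))
    where
    open DividesAt
    reach : ∀ d → DividesAt (b₀ + a) (d + b₀)
    reach d = along-a (along-b s d) (b₀ + a)

-- Closed forms at the points (1, q^2t) and (q², q^2t)

-- Used with N = 4t (SeedEven) and N = 4t + 2 (SeedOdd), Y = q^2t and P a multiple of (-q;q)_(N/2).
record SeedEven (N : ℕ) (Y P : Poly) : Set where
  field
    E-at-1  : Y *P E N oneP Y ≋ P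
    E-at-q² : E N (q²^ 1) Y ≋ P
    O-at-q² : O N (q²^ 1) Y ≋ []

SeedEven-resp : ∀ {N Y P P′} → P ≋ P′ → SeedEven N Y P → SeedEven N Y P′
SeedEven-resp P≋P′ s = record
  { E-at-1 = ≋-trans E-at-1 P≋P′ ; E-at-q² = ≋-trans E-at-q² P≋P′ ; O-at-q² = O-at-q² }
  where open SeedEven s

record SeedOdd (N : ℕ) (Y P : Poly) : Set where
  field
    E-at-1  : E N oneP Y ≋ []
    O-at-1  : O N oneP Y ≋ (Y *P Y) *P P
    O-at-q² : O N (q²^ 1) Y ≋ (Y *P (Y *P Y)) *P P

SeedOdd-resp : ∀ {N Y P P′} → P ≋ P′ → SeedOdd N Y P → SeedOdd N Y P′
SeedOdd-resp {Y = Y} P≋P′ s = record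
  { E-at-1  = E-at-1
  ; O-at-1  = ≋-trans O-at-1 (*P-congʳ (Y *P Y) P≋P′)
  ; O-at-q² = ≋-trans O-at-q² (*P-congʳ (Y *P (Y *P Y)) P≋P′)
  }
  where open SeedOdd s

seedEven⇒seedOdd : ∀ {N Y P} → q^ N ≋ Y *P Y → SeedEven N Y P → SeedOdd (2 + N) Y (P *P (oneP +P q *P Y))
seedEven⇒seedOdd {N} {Y} {P} q^N≋Y² s = record
  { E-at-1  = ≋-trans (+P-cong (*P-congʳ Y E₁-at-q²) (negP-cong (*P-congʳ oneP O₁-at-q²))) (cancel Y P)
  ; O-at-1  = ≋-trans (+P-cong (*P-congʳ Y E₁-at-1) (*P-congʳ (q *P Y) O₁-at-q²)) (factor₁ q Y P)
  ; O-at-q² = ≋-trans (O-suc-dual (suc N) oneP Y)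
      (≋-trans (+P-cong (*P-cong (*P-congʳ q q^N≋Y²) (*P-congʳ Y E₁-at-1)) (*P-congʳ Y O₁-at-q²)) (factor₂ q Y P))
  }
  where
  open SeedEven s
  E₁-at-1 : E (suc N) oneP Y ≋ Y *P P
  E₁-at-1 = ≋-trans (-P-≋[]ʳ _ (*P-≋[]ʳ oneP O-at-q²)) (*P-congʳ Y E-at-q²)
  E₁-at-q² : E (suc N) (q²^ 1) Y ≋ Y *P P
  E₁-at-q² = q*P-cancel (≋-trans (E-suc-dual N (q²^ 1) Y)
    (≋-trans (-P-≋[]ʳ _ (*P-≋[]ʳ (q^ N) (*P-≋[]ʳ (q²^ 1) O-at-q²))) (*P-congʳ q (*P-congʳ Y E-at-q²))))
  O₁-at-q² : O (suc N) (q²^ 1) Y ≋ (Y *P Y) *P P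
  O₁-at-q² = ≋-trans (O-suc-dual N oneP Y) (≋-trans (+P-≋[]ʳ _ (*P-≋[]ʳ Y O-at-q²)) (*P-cong q^N≋Y² E-at-1))
  cancel : ∀ y p → y *P (y *P p) -P oneP *P ((y *P y) *P p) ≋ []
  cancel = solve-∀ ℤ[q]
  factor₁ : ∀ q y p → y *P (y *P p) +P (q *P y) *P ((y *P y) *P p) ≋ (y *P y) *P (p *P (oneP +P q *P y))
  factor₁ = solve-∀ ℤ[q]
  factor₂ : ∀ q y p → (q *P (y *P y)) *P (y *P (y *P p)) +P y *P ((y *P y) *P p) ≋ (y *P (y *P y)) *P (p *P (oneP +P q *P y))
  factor₂ = solve-∀ ℤ[q]

record SeedOddNext (N : ℕ) (Y V : Poly) : Set where
  field
    E-at-q² : E N (q²^ 1) (q² *P Y) ≋ negP ((q *P q²) *P (Y *P V))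
    O-at-q² : O N (q²^ 1) (q² *P Y) ≋ (q *P (q² *P Y)) *P V
    O-at-q⁴ : O N (q²^ 2) (q² *P Y) ≋ (q² *P Y) *P V

seedOdd⇒seedOddNext : ∀ {N Y P} → q^ N ≋ q² *P (Y *P Y) → SeedOdd N Y P →
  SeedOddNext (suc N) Y (q²^ N *P ((Y *P (Y *P Y)) *P P))
seedOdd⇒seedOddNext {N} {Y} {P} q^N≋q²Y² s = record
  { E-at-q² = q*P-cancel (≋-trans (E-suc-dual N (q²^ 1) Y₁)
      (≋-trans (+P-cong (*P-≋[]ʳ q (*P-≋[]ʳ Y₁ E₀-at-q²)) (negP-cong (*P-cong q^N≋q²Y² (*P-congʳ (q²^ 1) O₀-at-q²))))
               (evaluate q Y G P)))
  ; O-at-q² = ≋-trans (+P-cong (*P-≋[]ʳ Y₁ E₀-at-q²) ≋-refl) (*P-congʳ (q *P Y₁) O₀-at-q⁴)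
  ; O-at-q⁴ = ≋-trans (O-suc-dual N (q²^ 1) Y₁)
      (≋-trans (+P-cong (*P-≋[]ʳ (q^ N) (*P-≋[]ʳ Y₁ E₀-at-q²)) ≋-refl) (*P-congʳ Y₁ O₀-at-q⁴))
  }
  where
  open SeedOdd s
  Y₁ G : Poly
  Y₁ = q² *P Y
  G  = q²^ N
  E₀-at-q² : E N (q²^ 1) Y₁ ≋ []
  E₀-at-q² = ≋-trans (E-homogeneous N oneP Y) (*P-≋[]ʳ G E-at-1)
  O₀-at-q² : O N (q²^ 1) Y₁ ≋ G *P ((Y *P Y) *P P)
  O₀-at-q² = ≋-trans (O-homogeneous N oneP Y) (*P-congʳ G O-at-1)
  O₀-at-q⁴ : O N (q²^ 2) Y₁ ≋ G *P ((Y *P (Y *P Y)) *P P)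
  O₀-at-q⁴ = ≋-trans (O-homogeneous N (q²^ 1) Y) (*P-congʳ G O-at-q²)
  evaluate : ∀ q y g p → [] -P ((q *P q) *P (y *P y)) *P (((q *P q) *P oneP) *P (g *P ((y *P y) *P p)))
                         ≋ q *P negP ((q *P (q *P q)) *P (y *P (g *P ((y *P (y *P y)) *P p))))
  evaluate = solve-∀ ℤ[q]

seedOddNext⇒seedEven : ∀ {N Y V} → q^ N ≋ q² *P (Y *P Y) → SeedOddNext (suc N) Y V →
  SeedEven (2 + N) (q² *P Y) (negP (q *P ((q² *P Y) *P (q² *P Y))) *P (V *P (oneP +P q *P (q *P Y))))
seedOddNext⇒seedEven {N} {Y} {V} q^N≋q²Y² s = record
  { E-at-1  = ≋-trans (*P-congʳ Y₁ (+P-cong (*P-congʳ Y₁ E-at-q²) (negP-cong (*P-congʳ oneP O-at-q²))))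
                      (evaluate₁ q Y V)
  ; E-at-q² = q*P-cancel (≋-trans (E-suc-dual (suc N) (q²^ 1) Y₁)
      (≋-trans (+P-cong (*P-congʳ q (*P-congʳ Y₁ E-at-q²))
                        (negP-cong (*P-cong (*P-congʳ q q^N≋q²Y²) (*P-congʳ (q²^ 1) O-at-q²))))
               (evaluate₂ q Y V)))
  ; O-at-q² = ≋-trans (+P-cong (*P-congʳ Y₁ E-at-q²) (*P-congʳ (q *P Y₁) O-at-q⁴)) (cancel q Y V)
  }
  where
  open SeedOddNext s
  Y₁ : Poly
  Y₁ = q² *P Y
  evaluate₁ : ∀ q y v →
    ((q *P q) *P y) *P (((q *P q) *P y) *P negP ((q *P (q *P q)) *P (y *P v)) -P oneP *P ((q *P ((q *P q) *P y)) *P v))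
    ≋ negP (q *P (((q *P q) *P y) *P ((q *P q) *P y))) *P (v *P (oneP +P q *P (q *P y)))
  evaluate₁ = solve-∀ ℤ[q]
  evaluate₂ : ∀ q y v →
    q *P (((q *P q) *P y) *P negP ((q *P (q *P q)) *P (y *P v)))
      -P (q *P ((q *P q) *P (y *P y))) *P (((q *P q) *P oneP) *P ((q *P ((q *P q) *P y)) *P v))
    ≋ q *P (negP (q *P (((q *P q) *P y) *P ((q *P q) *P y))) *P (v *P (oneP +P q *P (q *P y))))
  evaluate₂ = solve-∀ ℤ[q]
  cancel : ∀ q y v → ((q *P q) *P y) *P negP ((q *P (q *P q)) *P (y *P v)) +P (q *P ((q *P q) *P y)) *P (((q *P q) *P y) *P v) ≋ []
  cancel = solve-∀ ℤ[q]

∏1+q^-suc-double : ∀ t → ∏1+q^ (suc (double t)) ≋ ∏1+q^ (double t) *P (oneP +P q *P q²^ t)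
∏1+q^-suc-double t = *P-congʳ (∏1+q^ (double t)) (+P-cong {oneP} ≋-refl (*P-congʳ q (q^-double t)))

∏1+q^-double-suc : ∀ t → ∏1+q^ (suc (suc (double t))) ≋ ∏1+q^ (suc (double t)) *P (oneP +P q *P (q *P q²^ t))
∏1+q^-double-suc t = *P-congʳ (∏1+q^ (suc (double t))) (+P-cong {oneP} ≋-refl (*P-congʳ q (*P-congʳ q (q^-double t))))

seedEven⇒seedOdd-at : ∀ t → Σ Poly (λ c → SeedEven (double (double t)) (q²^ t) (c *P ∏1+q^ (double t))) →
  Σ Poly λ c → SeedOdd (2 + double (double t)) (q²^ t) (c *P ∏1+q^ (suc (double t)))
seedEven⇒seedOdd-at t (c , s) = c , SeedOdd-resp regroup (seedEven⇒seedOdd (q^-quadruple t) s)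
  where
  assoc : ∀ a b c → (a *P b) *P c ≋ a *P (b *P c)
  assoc = solve-∀ ℤ[q]
  regroup : (c *P ∏1+q^ (double t)) *P (oneP +P q *P q²^ t) ≋ c *P ∏1+q^ (suc (double t))
  regroup = ≋-trans (assoc c (∏1+q^ (double t)) (oneP +P q *P q²^ t)) (*P-congʳ c (≋-sym (∏1+q^-suc-double t)))

seedOdd⇒seedEven-at : ∀ t → Σ Poly (λ c → SeedOdd (2 + double (double t)) (q²^ t) (c *P ∏1+q^ (suc (double t)))) →
  Σ Poly λ c → SeedEven (double (double (suc t))) (q²^ (suc t)) (c *P ∏1+q^ (double (suc t)))
seedOdd⇒seedEven-at t (c , s) =
  c′ , subst₂ (λ N j → SeedEven N (q²^ (suc t)) (c′ *P ∏1+q^ j)) (sym quadruple-suc) (sym (double-suc t))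
              (SeedEven-resp regroup (seedOddNext⇒seedEven q^N≋q²Y² (seedOdd⇒seedOddNext q^N≋q²Y² s)))
  where
  Y G c′ : Poly
  Y  = q²^ t
  G  = q²^ (2 + double (double t))
  c′ = negP (q *P ((q² *P Y) *P (q² *P Y))) *P ((G *P (Y *P (Y *P Y))) *P c)
  q^N≋q²Y² : q^ (2 + double (double t)) ≋ q² *P (Y *P Y)
  q^N≋q²Y² = ≋-trans (*P-congʳ q (*P-congʳ q (q^-quadruple t))) (≋-sym (*P-assoc q q (Y *P Y)))
  quadruple-suc : double (double (suc t)) ≡ 4 + double (double t)
  quadruple-suc = trans (cong double (double-suc t)) (trans (double-suc (suc (double t))) (cong (suc ∘ suc) (double-suc (double t))))
  reassoc : ∀ a g y c p u → a *P ((g *P (y *P (c *P p))) *P u) ≋ (a *P ((g *P y) *P c)) *P (p *P u)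
  reassoc = solve-∀ ℤ[q]
  regroup : negP (q *P ((q² *P Y) *P (q² *P Y))) *P ((G *P ((Y *P (Y *P Y)) *P (c *P ∏1+q^ (suc (double t))))) *P (oneP +P q *P (q *P Y)))
            ≋ c′ *P ∏1+q^ (suc (suc (double t)))
  regroup = ≋-trans (reassoc (negP (q *P ((q² *P Y) *P (q² *P Y)))) G (Y *P (Y *P Y)) c (∏1+q^ (suc (double t))) (oneP +P q *P (q *P Y)))
                    (*P-congʳ c′ (≋-sym (∏1+q^-double-suc t)))

-- The constants are c = (-1)ᵗ q^(9t²).
seedEven : ∀ t → Σ Poly λ c → SeedEven (double (double t)) (q²^ t) (c *P ∏1+q^ (double t))
seedEven zero    = oneP , record { E-at-1 = ≋-refl ; E-at-q² = ≋-refl ; O-at-q² = ≋-refl }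
seedEven (suc t) = seedOdd⇒seedEven-at t (seedEven⇒seedOdd-at t (seedEven t))

seedOdd : ∀ t → Σ Poly λ c → SeedOdd (2 + double (double t)) (q²^ t) (c *P ∏1+q^ (suc (double t)))
seedOdd t = seedEven⇒seedOdd-at t (seedEven t)

seedEven⇒DividesAt : ∀ {D N} b → Σ Poly (λ c → SeedEven N (q²^ b) (c *P D)) → Propagation.DividesAt D N 0 b
seedEven⇒DividesAt {D} {N} b (c , s) = record
  { E-at-suc = ∣q-resp (≋-sym (≋-trans E-at-q² (*P-comm c D))) (∣q-multiple c)
  ; E-at     = ∣q-cancel-q²^ b (∣q-resp (≋-sym (≋-trans E-at-1 (*P-comm c D))) (∣q-multiple c))
  ; O-at-suc = ∣q-resp (≋-sym O-at-q²) ∣q-zero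
  }
  where open SeedEven s

seedOdd⇒DividesAt : ∀ {D N} b → Σ Poly (λ c → SeedOdd N (q²^ b) (c *P D)) → Propagation.DividesAt D N 0 b
seedOdd⇒DividesAt {D} {N} b (c , s) = record
  { E-at-suc = E-next 0 b E-at O-at O-at-suc
  ; E-at     = E-at
  ; O-at-suc = O-at-suc
  }
  where
  open Propagation D N using (E-next)
  Y : Poly
  Y = q²^ b
  c*D : D ∣q c *P D
  c*D = ∣q-resp (*P-comm D c) (∣q-multiple c)
  E-at : D ∣q E N oneP Y
  E-at = ∣q-resp (≋-sym (SeedOdd.E-at-1 s)) ∣q-zero
  O-at : D ∣q O N oneP Y
  O-at = ∣q-resp (≋-sym (SeedOdd.O-at-1 s)) (∣q-*ˡ (Y *P Y) c*D)
  O-at-suc : D ∣q O N (q²^ 1) Y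
  O-at-suc = ∣q-resp (≋-sym (SeedOdd.O-at-q² s)) (∣q-*ˡ (Y *P (Y *P Y)) c*D)

even-or-odd : ∀ n → Σ ℕ λ t → n ≡ double t ⊎ n ≡ suc (double t)
even-or-odd zero = 0 , inj₁ refl
even-or-odd (suc n) with even-or-odd n
... | t , inj₁ refl = t , inj₂ refl
... | t , inj₂ refl = suc t , inj₁ (sym (double-suc t))

∏1+q^-divides : ∀ n a b → ∏1+q^ n ∣q E (double n) (q²^ a) (q²^ b) × ∏1+q^ n ∣q O (double n) (q²^ a) (q²^ b)
∏1+q^-divides n a b = by-parity (even-or-odd n)
  where
  divides-at : ℕ → ℕ → Set
  divides-at n N = ∏1+q^ n ∣q E N (q²^ a) (q²^ b) × ∏1+q^ n ∣q O N (q²^ a) (q²^ b)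
  by-parity : Σ ℕ (λ t → n ≡ double t ⊎ n ≡ suc (double t)) → divides-at n (double n)
  by-parity (t , inj₁ refl) = Propagation.divides-everywhere _ _ (seedEven⇒DividesAt t (seedEven t)) a b
  by-parity (t , inj₂ refl) = subst (divides-at (suc (double t))) (sym (double-suc (double t)))
    (Propagation.divides-everywhere _ _ (seedOdd⇒DividesAt t (seedOdd t)) a b)

S T : ℕ → ℕ → Poly
S m n = sumP (suc n) (λ k → signP k (qpow (k * (k ∸ 1) + 2 * m * (n ∸ k)) *P qbin (2 * n) (2 * k)))
T m n = sumP n (λ k → signP k (qpow (k * (k ∸ 1) + 2 * m * (n ∸ 1 ∸ k)) *P qbin (2 * n) (2 * k + 1)))

U : ℕ → ℕ → ℕ → Poly
U m n δ = sumP (suc n) (λ k → signP k (qpow (k * (k + 2 * m ∸ 1)) *P qbin (2 * n) (2 * k + δ)))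

sumP-factor-q^ : ∀ K d {N N′} (j j′ e e′ : ℕ → ℕ) → N ≡ N′ → (∀ k → j k ≡ j′ k) → (∀ k → j k ≤ N → e k ≡ d + e′ k) →
  sumP K (λ k → sign k *P (q^ (e k) *P qbin N (j k))) ≋ q^ d *P sumP K (λ k → signP k (qpow (e′ k) *P qbin N′ (j′ k)))
sumP-factor-q^ K d {N} {N′} j j′ e e′ N≡N′ j≡j′ e≡d+e′ =
  ≋-trans (sumP-cong K (λ k → ≋-trans (factor-q^-qbin d k (e≡d+e′ k)) (*P-congʳ (q^ d) (to-signP k))))
          (sumP-*ˡ K (q^ d) _)
  where
  qbin-cong : ∀ {N N′ j j′} → N ≡ N′ → j ≡ j′ → qbin N j ≋ qbin N′ j′
  qbin-cong refl refl = ≋-refl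
  to-signP : ∀ k → sign k *P (q^ (e′ k) *P qbin N (j k)) ≋ signP k (qpow (e′ k) *P qbin N′ (j′ k))
  to-signP k = ≋-trans (*P-congʳ (sign k) (*P-cong (≋-sym (qpow≋q^ (e′ k))) (qbin-cong N≡N′ (j≡j′ k))))
                       (≋-sym (signP≋sign*P k _))

double≡2* : ∀ n → double n ≡ 2 * n
double≡2* n = cong (λ x → n + x) (sym (+-identityʳ n))

suc-double≡2*+1 : ∀ n → suc (double n) ≡ 2 * n + 1
suc-double≡2*+1 n = trans (cong suc (double≡2* n)) (sym (+-comm (2 * n) 1))

half-≤ : ∀ {k n} → double k ≤ double n → k ≤ n
half-≤ {zero}          _       = z≤n
half-≤ {suc k} {suc n} (s≤s p) = s≤s (half-≤ (≤-pred (subst₂ _≤_ (+-suc k k) (+-suc n n) p)))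

half-< : ∀ {k n} → suc (double k) ≤ double n → k < n
half-< {k} {n} p = ≰⇒> λ n≤k → <-irrefl refl (≤-trans p (+-mono-≤ n≤k n≤k))

double<double-suc : ∀ n → double n < double (suc n)
double<double-suc n = s≤s (+-monoʳ-≤ n (n≤1+n n))

E-at-1≋S : ∀ m n → E (double n) oneP (q²^ m) ≋ q^ (double m * n) *P S m n
E-at-1≋S m n = ≋-trans (E-sum (double n) 0 m (suc n) (double<double-suc n))
  (sumP-factor-q^ (suc n) (double m * n) double (2 *_) _ _ (double≡2* n) double≡2*
    (λ k 2k≤2n → exponent-eq k (half-≤ 2k≤2n)))
  where
  identity : ∀ p m n d → p + 0 + (m + m) * (n + d) ≡ (m + m) * n + (p + 2 * m * d)
  identity = ℕ-solve-∀
  exponent-eq : ∀ k → k ≤ n → exponent (double n) 0 m k ≡ double m * n + (k * (k ∸ 1) + 2 * m * (n ∸ k))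
  exponent-eq k k≤n = trans (cong (λ d → k * (k ∸ 1) + 0 + double m * d) (+-∸-assoc n k≤n)) (identity (k * (k ∸ 1)) m n (n ∸ k))

O-at-1≋T : ∀ m n → O (double n) oneP (q²^ m) ≋ q^ (double m * suc n) *P T m n
O-at-1≋T m n = ≋-trans (O-sum (double n) 0 m n ≤-refl)
  (sumP-factor-q^ n (double m * suc n) (suc ∘ double) (λ k → 2 * k + 1) _ _ (double≡2* n) suc-double≡2*+1
    (λ k 2k+1≤2n → exponent-eq n k (half-< 2k+1≤2n)))
  where
  identity : ∀ p m n d → p + 0 + (m + m) * ((1 + n) + (1 + d)) ≡ (m + m) * (1 + (1 + n)) + (p + 2 * m * d)
  identity = ℕ-solve-∀
  exponent-eq : ∀ n k → k < n → exponent (double n) 0 m k ≡ double m * suc n + (k * (k ∸ 1) + 2 * m * (n ∸ 1 ∸ k))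
  exponent-eq (suc n) k (s≤s k≤n) =
    trans (cong (λ d → k * (k ∸ 1) + 0 + double m * d) (trans (+-∸-assoc (suc n) (m≤n⇒m≤1+n k≤n)) (cong (λ x → suc n + x) (suc-∸ k≤n))))
          (identity (k * (k ∸ 1)) m n (n ∸ k))

exponent-at-y=1 : ∀ N m k → exponent N m 0 k ≡ 0 + k * (k + 2 * m ∸ 1)
exponent-at-y=1 N m zero    = cong (_+ 0) (*-zeroʳ (double m))
exponent-at-y=1 N m (suc k) = identity k m
  where
  identity : ∀ k m → (1 + k) * k + (m + m) * (1 + k) + 0 ≡ (1 + k) * (k + 2 * m)
  identity = ℕ-solve-∀

E-at-y=1≋U₀ : ∀ m n → E (double n) (q²^ m) oneP ≋ q^ 0 *P U m n 0
E-at-y=1≋U₀ m n = ≋-trans (E-sum (double n) m 0 (suc n) (double<double-suc n))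
  (sumP-factor-q^ (suc n) 0 double (λ k → 2 * k + 0) _ _ (double≡2* n) (λ k → trans (double≡2* k) (sym (+-identityʳ _)))
    (λ k _ → exponent-at-y=1 (double n) m k))

O-at-y=1≋U₁ : ∀ m n → O (double n) (q²^ m) oneP ≋ q^ 0 *P U m n 1
O-at-y=1≋U₁ m n = ≋-trans (O-sum (double n) m 0 (suc n) (m<n⇒m<1+n (double<double-suc n)))
  (sumP-factor-q^ (suc n) 0 (suc ∘ double) (λ k → 2 * k + 1) _ _ (double≡2* n) suc-double≡2*+1
    (λ k _ → exponent-at-y=1 (double n) m k))

theorem3p1 : ∀ (m n : ℕ) →
    (poch (negP (qpow 1)) n ∣P
      sumP (suc n) (λ k → signP k (qpow (k * (k ∸ 1) + 2 * m * (n ∸ k)) *P qbin (2 * n) (2 * k))))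
    × (poch (negP (qpow 1)) n ∣P
      sumP n (λ k → signP k (qpow (k * (k ∸ 1) + 2 * m * (n ∸ 1 ∸ k)) *P qbin (2 * n) (2 * k + 1))))
    × (∀ (δ : ℕ) → δ ≤ 1 → poch (negP (qpow 1)) n ∣P
      sumP (suc n) (λ k → signP k (qpow (k * (k + 2 * m ∸ 1)) *P qbin (2 * n) (2 * k + δ))))
theorem3p1 m n =
    poch-∣P n (double m * n)     (proj₁ (∏1+q^-divides n 0 m)) (E-at-1≋S m n)
  , poch-∣P n (double m * suc n) (proj₂ (∏1+q^-divides n 0 m)) (O-at-1≋T m n)
  , λ where
      zero          _         → poch-∣P n 0 (proj₁ (∏1+q^-divides n m 0)) (E-at-y=1≋U₀ m n)
      (suc zero)    _         → poch-∣P n 0 (proj₂ (∏1+q^-divides n m 0)) (O-at-y=1≋U₁ m n)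
      (suc (suc δ)) (s≤s ())
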